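{- Let $P \in \mathcal{C}(G_n)$, and let $k \in Q_n$. Then the following are equivalent: (1) The set $\{k\}$ is separable with respect to $P$. (2) The $k^{th}$ column of $P$ is of the form $\begin{pmatrix} 1 & 1 & \cdots & 1 & 0 & \cdots & 0 \end{pmatrix}^\top$ (first $2^{n-1}$ entries $1$, last $2^{n-1}$ entries $0$), or its bitwise complement. (3) The matrix $P$ is equal to $P_1 \,\mathrm{stack}_k^1\, P_2$ or $P_1 \,\mathrm{stack}_k^0\, P_2$ for some $P_1 \in \mathcal{C}(G_{n-1})$ and $P_2 \in \mathcal{S}(P_1)$.
   Context: Let $Q_n=\{1,\dots,n\}$ be a set of $n$ yes/no questions; an outcome on $S\subseteq Q_n$ is an element of $\{0,1\}^{|S|}$. A preference matrix on $Q_n$ is a $2^n\times n$ 0-1 matrix whose rows are the $2^n$ outcomes, each exactly once, ordered from most to least preferred. For a nonempty proper $S\subset Q_n$ and outcome $x$ on $Q_n-S$, $P^{[Q_n-S,x]}$ is the submatrix formed by the columns in $S$ and rows with outcome $x$ on $Q_n-S$ (in order); $S$ is separable with respect to $P$ if all these submatrices coincide for all $x$. $\mathcal{C}(G_n)$ is the set of preference matrices generated by Hamiltonian paths in the $n$-dimensional hypercube graph $G_n$ with Gray code labeling, i.e. preference matrices in which consecutive rows differ in exactly one entry. For $A\in\mathcal{C}(G_{n-1})$, $\mathcal{S}(A)$ is the set of $B\in\mathcal{C}(G_{n-1})$ whose first row equals the last row of $A$. For $B\in\mathcal{S}(A)$ and $k\in\{1,\dots,n\}$, $A\,\mathrm{stack}_k^1\,B$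 is the $2^{n}\times n$ matrix obtained by placing $A$ above $B$ and inserting a new column in position $k$ (shifting later columns right) whose top half entries are $1$ and bottom half entries are $0$; $A\,\mathrm{stack}_k^0\,B$ is the same but with the new column bitwise complemented. -}

module Defs where

open import Data.Nat using (ℕ; zero; suc; _+_; _^_; _<ᵇ_)
open import Data.Nat.Properties using (+-identityʳ)
open import Data.Bool using (Bool; true; false; not)
open import Data.Bool.Properties renaming (_≟_ to _≟ᵇ_)
open import Data.Fin using (Fin; toℕ; splitAt; cast)
open import Data.Vec using (Vec; lookup; insertAt; removeAt)
open import Data.Vec.Properties using (≡-dec)
open import Data.List using (List; map; filter)
open import Data.List.Base using (allFin)
open import Data.Sum using (inj₁; inj₂)
open import Data.Product using (Σ; ∃; _×_)
open import Relation.Nullary using (¬_)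
open import Relation.Binary.PropositionalEquality using (_≡_; _≢_)

-- An outcome on n questions is a Vec Bool n (true = 1, false = 0).
-- A 2^n × n 0-1 matrix is given by its rows: row i (i = 0 is top / most preferred).
Matrix : ℕ → Set
Matrix n = Fin (2 ^ n) → Vec Bool n

IsPreferenceMatrix : (n : ℕ) → Matrix n → Set
IsPreferenceMatrix n P =
  (∀ i j → P i ≡ P j → i ≡ j) × (∀ (x : Vec Bool n) → ∃ λ i → P i ≡ x)

DifferInExactlyOne : {n : ℕ} → Vec Bool n → Vec Bool n → Set
DifferInExactlyOne {n} u v =
  ∃ λ (c : Fin n) → (lookup u c ≢ lookup v c) × (∀ d → d ≢ c → lookup u d ≡ lookup v d)

InC : (n : ℕ) → Matrix n → Set
InC n P = IsPreferenceMatrix n P ×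
  (∀ (i j : Fin (2 ^ n)) → toℕ j ≡ suc (toℕ i) → DifferInExactlyOne (P i) (P j))

InS : (m : ℕ) → Matrix m → Matrix m → Set
InS m A B = InC m B ×
  (∀ (i j : Fin (2 ^ m)) → toℕ i ≡ 0 → suc (toℕ j) ≡ 2 ^ m → B i ≡ A j)

-- The submatrix P^{[Q_n - {k}, x]}: the k-th entries of the rows whose
-- outcome on Q_n - {k} (i.e. the row with entry k removed) is x, in order.
subMatrixSingleton : (m : ℕ) → Matrix (suc m) → Fin (suc m) → Vec Bool m → List Bool
subMatrixSingleton m P k x =
  map (λ i → lookup (P i) k)
      (filter (λ i → ≡-dec _≟ᵇ_ (removeAt (P i) k) x) (allFin (2 ^ suc m)))

SeparableSingleton : (m : ℕ) → Matrix (suc m) → Fin (suc m) → Set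
SeparableSingleton m P k = ∀ (x y : Vec Bool m) →
  subMatrixSingleton m P k x ≡ subMatrixSingleton m P k y

ColumnTopOnes : (m : ℕ) → Matrix (suc m) → Fin (suc m) → Set
ColumnTopOnes m P k = ∀ i → lookup (P i) k ≡ (toℕ i <ᵇ 2 ^ m)

ColumnTopZeros : (m : ℕ) → Matrix (suc m) → Fin (suc m) → Set
ColumnTopZeros m P k = ∀ i → lookup (P i) k ≡ not (toℕ i <ᵇ 2 ^ m)

-- A stack_k^b B: A above B, with a new column at position k whose top half is b
-- and bottom half is not b.  (stack^1 : b = true, stack^0 : b = false.)
-- Note 2 ^ suc m reduces to 2 ^ m + (2 ^ m + 0).
stack : (m : ℕ) → Bool → Fin (suc m) → Matrix m → Matrix m → Matrix (suc m)
stack m b k A B i with splitAt (2 ^ m) i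
... | inj₁ i₁ = insertAt (A i₁) k b
... | inj₂ i₂ = insertAt (B (cast (+-identityʳ (2 ^ m)) i₂)) k (not b)

_≋_ : {n : ℕ} → Matrix n → Matrix n → Set
P ≋ Q = ∀ i → P i ≡ Q i

-- Write c for column k of P and r for P with column k deleted.  Since the rows of P are all
-- outcomes, every r-value x occurs in exactly two rows, one with c = b and one with c = not b;
-- separability says that for all x these two rows come in the same order, b first.  Along the
-- Gray-code path, a step that changes c changes nothing else, so it joins the two rows of one
-- r-value and must therefore go from b to not b: the column is b up to some row and not b
-- afterwards.  Exchanging the two rows of each r-value is an injection between these two blocks,
-- so both have 2^m rows, which is (2).  Cutting such a P in half and deleting column k gives two
-- Gray-code paths of G_m glued along one edge, which is (3); conversely the new column of a
-- stack is of the form (2), and (2) makes all the submatrices equal to (b, not b).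

module Submission where

open import Defs
open import Data.Bool using (Bool; true; false; not)
open import Data.Bool.Properties using (not-involutive; not-injective; not-¬; ¬-not)
  renaming (_≟_ to _≟ᵇ_)
open import Data.Fin using (Fin; zero; suc; toℕ; fromℕ<; splitAt; cast; punchIn; punchOut; _↑ˡ_; _↑ʳ_)
import Data.Fin.Properties as Fin
open import Data.Fin.Properties
  using (toℕ-injective; toℕ-fromℕ<; fromℕ<-injective; toℕ<n; toℕ-↑ˡ; toℕ-↑ʳ; toℕ-cast; cast-involutive;
         splitAt⁻¹-↑ˡ; splitAt⁻¹-↑ʳ; punchIn-injective; punchInᵢ≢i; punchIn-punchOut; injective⇒≤)
open import Data.List using (List; []; _∷_; map; filter; tabulate)
open import Data.List.Properties using (filter-accept; filter-reject; filter-none; ∷-injectiveˡ)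
open import Data.List.Relation.Unary.All.Properties using (tabulate⁺)
open import Data.Nat using (ℕ; zero; suc; _+_; _∸_; _^_; _<ᵇ_; _≤_; _<_; z≤n; s≤s; s≤s⁻¹)
open import Data.Nat.Properties
open import Data.Product using (Σ; ∃; _×_; _,_; proj₁; proj₂)
import Data.Product as Product
open import Data.Sum using (_⊎_; inj₁; inj₂)
import Data.Sum as Sum
open import Data.Vec using (Vec; _∷_; lookup; insertAt; removeAt; replicate)
import Data.Vec as Vec
open import Data.Vec.Properties
  using (≡-dec; insertAt-lookup; insertAt-removeAt; removeAt-insertAt; removeAt-punchOut;
         tabulate∘lookup; tabulate-cong)
open import Function using (_∘_; id)
open import Function.Bundles using (_⇔_; mk⇔; Equivalence)
open import Function.Construct.Composition using (_⇔-∘_)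
open import Function.Construct.Symmetry using (⇔-sym)
open import Function.Definitions using (Injective)
open import Relation.Binary.Definitions using (tri<; tri≈; tri>)
open import Relation.Binary.PropositionalEquality
open import Relation.Nullary using (¬_; yes; no; contradiction)
open import Relation.Nullary.Reflects using (ofʸ; ofⁿ)
open import Relation.Unary using (Pred; Decidable)

lookup-removeAt : ∀ {a} {A : Set a} {n} (xs : Vec A (suc n)) i j →
                  lookup (removeAt xs i) j ≡ lookup xs (punchIn i j)
lookup-removeAt (x ∷ xs)     zero    j       = refl
lookup-removeAt (x ∷ y ∷ xs) (suc i) zero    = refl
lookup-removeAt (x ∷ y ∷ xs) (suc i) (suc j) = lookup-removeAt (y ∷ xs) i j

lookup-ext : ∀ {a} {A : Set a} {n} {u v : Vec A n} → (∀ i → lookup u i ≡ lookup v i) → u ≡ v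
lookup-ext {u = u} {v} eq = begin
  u                       ≡⟨ tabulate∘lookup u ⟨
  Vec.tabulate (lookup u) ≡⟨ tabulate-cong eq ⟩
  Vec.tabulate (lookup v) ≡⟨ tabulate∘lookup v ⟩
  v                       ∎
  where open ≡-Reasoning

differsAt⇒removeAt-≡ : ∀ {n} {u v : Vec Bool (suc n)} k → DifferInExactlyOne u v →
                       lookup u k ≢ lookup v k → removeAt u k ≡ removeAt v k
differsAt⇒removeAt-≡ {u = u} {v} k (c , _ , agree) uₖ≢vₖ with c Fin.≟ k
... | no c≢k   = contradiction (agree k (c≢k ∘ sym)) uₖ≢vₖ
... | yes refl = lookup-ext λ d → begin
  lookup (removeAt u c) d ≡⟨ lookup-removeAt u c d ⟩
  lookup u (punchIn c d)  ≡⟨ agree (punchIn c d) (punchInᵢ≢i c d) ⟩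
  lookup v (punchIn c d)  ≡⟨ lookup-removeAt v c d ⟨
  lookup (removeAt v c) d ∎
  where open ≡-Reasoning

agreesAt⇒removeAt-differs : ∀ {n} {u v : Vec Bool (suc n)} k → DifferInExactlyOne u v →
                            lookup u k ≡ lookup v k →
                            DifferInExactlyOne (removeAt u k) (removeAt v k)
agreesAt⇒removeAt-differs {u = u} {v} k (c , uᶜ≢vᶜ , agree) uₖ≡vₖ with k Fin.≟ c
... | yes refl = contradiction uₖ≡vₖ uᶜ≢vᶜ
... | no k≢c   = punchOut k≢c , differs , agrees
  where
  differs : lookup (removeAt u k) (punchOut k≢c) ≢ lookup (removeAt v k) (punchOut k≢c)
  differs rewrite removeAt-punchOut u k≢c | removeAt-punchOut v k≢c = uᶜ≢vᶜ

  agrees : ∀ d → d ≢ punchOut k≢c → lookup (removeAt u k) d ≡ lookup (removeAt v k) d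
  agrees d d≢ rewrite lookup-removeAt u k d | lookup-removeAt v k d =
    agree (punchIn k d) λ eq → d≢ (punchIn-injective k d _ (trans eq (sym (punchIn-punchOut k≢c))))

module _ {a p} {A : Set a} {P : Pred A p} (P? : Decidable P) where

  filter-tabulate-single : ∀ {n} (g : Fin n → A) {i} → P (g i) → (∀ l → P (g l) → l ≡ i) →
                           filter P? (tabulate g) ≡ g i ∷ []
  filter-tabulate-single {suc n} g {zero} pᵢ only =
    trans (filter-accept P? pᵢ)
          (cong (g zero ∷_) (filter-none P? (tabulate⁺ λ l p → case (only (suc l) p))))
    where
    case : ∀ {l : Fin n} → suc l ≢ zero
    case ()
  filter-tabulate-single g {suc i} pᵢ only =
    trans (filter-reject P? λ p → case (only zero p))
          (filter-tabulate-single (g ∘ suc) pᵢ (λ l p → Fin.suc-injective (only (suc l) p)))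
    where
    case : zero ≢ suc i
    case ()

  filter-tabulate-pair : ∀ {n} (g : Fin n → A) {i j} → toℕ i < toℕ j → P (g i) → P (g j) →
                         (∀ l → P (g l) → l ≡ i ⊎ l ≡ j) →
                         filter P? (tabulate g) ≡ g i ∷ g j ∷ []
  filter-tabulate-pair g {zero} {suc j} _ pᵢ pⱼ only =
    trans (filter-accept P? pᵢ)
          (cong (g zero ∷_) (filter-tabulate-single (g ∘ suc) pⱼ
            (λ l p → Sum.[ (λ ()) , Fin.suc-injective ] (only (suc l) p))))
  filter-tabulate-pair g {suc i} {suc j} (s≤s i<j) pᵢ pⱼ only =
    trans (filter-reject P? λ p → Sum.[ (λ ()) , (λ ()) ] (only zero p))
          (filter-tabulate-pair (g ∘ suc) i<j pᵢ pⱼ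
            (λ l p → Sum.map Fin.suc-injective Fin.suc-injective (only (suc l) p)))

step-closed⇒upward-closed : ∀ {n ℓ} (Q : Pred (Fin n) ℓ) →
                            (∀ {i j} → toℕ j ≡ suc (toℕ i) → Q i → Q j) →
                            ∀ {i j} → toℕ i ≤ toℕ j → Q i → Q j
step-closed⇒upward-closed {n} Q step {i} {j} i≤j =
  reach (toℕ j ∸ toℕ i) j (sym (m∸n+n≡m i≤j))
  where
  reach : ∀ d l → toℕ l ≡ d + toℕ i → Q i → Q l
  reach zero    l l≡i   = subst Q (toℕ-injective (sym l≡i))
  reach (suc d) l l≡1+d+i qᵢ =
    step (trans l≡1+d+i (cong suc (sym (toℕ-fromℕ< d+i<n)))) (reach d _ (toℕ-fromℕ< d+i<n) qᵢ)
    where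
    d+i<n : d + toℕ i < n
    d+i<n = <-trans (n<1+n _) (subst (_< n) l≡1+d+i (toℕ<n l))

interval-injection⇒≤ : ∀ {n} (σ : Fin n → Fin n) → Injective _≡_ _≡_ σ →
                       ∀ {a r c s} → a + r ≤ n →
                       (∀ i → a ≤ toℕ i → toℕ i < a + r → c ≤ toℕ (σ i) × toℕ (σ i) < c + s) →
                       r ≤ s
interval-injection⇒≤ {n} σ σ-injective {a} {r} {c} {s} a+r≤n maps-into = injective⇒≤ g-injective
  where
  a+j<a+r : (j : Fin r) → a + toℕ j < a + r
  a+j<a+r j = +-monoʳ-< a (toℕ<n j)

  embed : Fin r → Fin n
  embed j = fromℕ< (<-≤-trans (a+j<a+r j) a+r≤n)

  bounds : ∀ j → c ≤ toℕ (σ (embed j)) × toℕ (σ (embed j)) < c + s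
  bounds j = maps-into (embed j) (subst (a ≤_) (sym (toℕ-fromℕ< _)) (m≤m+n a _))
                                 (subst (_< a + r) (sym (toℕ-fromℕ< _)) (a+j<a+r j))

  g : Fin r → Fin s
  g j = fromℕ< (subst (toℕ (σ (embed j)) ∸ c <_) (m+n∸m≡n c s)
                      (∸-monoˡ-< (proj₂ (bounds j)) (proj₁ (bounds j))))

  g-injective : Injective _≡_ _≡_ g
  g-injective {i} {j} gᵢ≡gⱼ =
    toℕ-injective (+-cancelˡ-≡ a _ _ (fromℕ<-injective _ _ _ _ (σ-injective (toℕ-injective
      (∸-cancelʳ-≡ (proj₁ (bounds i)) (proj₁ (bounds j)) (fromℕ<-injective _ _ _ _ gᵢ≡gⱼ))))))

SplitsAt : ∀ {n} → ℕ → Bool → (Fin n → Bool) → Set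
SplitsAt N b f = ∀ i → (toℕ i < N → f i ≡ b) × (N ≤ toℕ i → f i ≡ not b)

module _ {n N} {f : Fin n → Bool} {b} (split : SplitsAt N b f) where

  splitsAt-≡⇒< : ∀ {i} → f i ≡ b → toℕ i < N
  splitsAt-≡⇒< fᵢ≡b = ≰⇒> λ N≤i → not-¬ fᵢ≡b (proj₂ (split _) N≤i)

  splitsAt-≡not⇒≥ : ∀ {i} → f i ≡ not b → N ≤ toℕ i
  splitsAt-≡not⇒≥ fᵢ≡¬b = ≮⇒≥ λ i<N → not-¬ (proj₁ (split _) i<N) fᵢ≡¬b

splitsAt⇔≡<ᵇ : ∀ {n N} {f : Fin n → Bool} (g : Bool → Bool) → g false ≡ not (g true) →
               SplitsAt N (g true) f ⇔ (∀ i → f i ≡ g (toℕ i <ᵇ N))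
splitsAt⇔≡<ᵇ {N = N} {f} g g-false = mk⇔ to from
  where
  to : SplitsAt N (g true) f → ∀ i → f i ≡ g (toℕ i <ᵇ N)
  to split i with toℕ i <ᵇ N | <ᵇ-reflects-< (toℕ i) N
  ... | true  | ofʸ i<N = proj₁ (split i) i<N
  ... | false | ofⁿ i≮N = trans (proj₂ (split i) (≮⇒≥ i≮N)) (sym g-false)

  from : (∀ i → f i ≡ g (toℕ i <ᵇ N)) → SplitsAt N (g true) f
  from eq i with toℕ i <ᵇ N | <ᵇ-reflects-< (toℕ i) N | eq i
  ... | true  | ofʸ i<N | fᵢ = (λ _ → fᵢ) , λ N≤i → contradiction i<N (≤⇒≯ N≤i)
  ... | false | ofⁿ i≮N | fᵢ = (λ i<N → contradiction i<N i≮N) , λ _ → trans fᵢ g-false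

-- If the split point were not N, σ would inject [i, i + N) into [0, i), resp. [0, N] into (i, i + N).
module UpwardClosedSwapped {n N} (n≡N+N : n ≡ N + N) (f : Fin n → Bool) (b : Bool)
  (upward : ∀ {i j} → toℕ i ≤ toℕ j → f i ≡ not b → f j ≡ not b)
  (σ : Fin n → Fin n) (σ-injective : Injective _≡_ _≡_ σ) (σ-flips : ∀ i → f (σ i) ≡ not (f i))
  where

  b-before-not-b : ∀ {x y} → f x ≡ b → f y ≡ not b → toℕ x < toℕ y
  b-before-not-b fx≡b fy≡¬b = ≰⇒> λ y≤x → not-¬ fx≡b (upward y≤x fy≡¬b)

  lower-half : ∀ i → toℕ i < N → f i ≡ b
  lower-half i i<N with f i ≟ᵇ b
  ... | yes fᵢ≡b = fᵢ≡b
  ... | no  fᵢ≢b = contradiction (interval-injection⇒≤ σ σ-injective i+N≤n maps) (<⇒≱ i<N)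
    where
    fᵢ≡¬b : f i ≡ not b
    fᵢ≡¬b = ¬-not fᵢ≢b

    i+N≤n : toℕ i + N ≤ n
    i+N≤n = ≤-trans (+-monoˡ-≤ N (<⇒≤ i<N)) (≤-reflexive (sym n≡N+N))

    maps : ∀ j → toℕ i ≤ toℕ j → toℕ j < toℕ i + N → 0 ≤ toℕ (σ j) × toℕ (σ j) < toℕ i
    maps j i≤j _ = z≤n , b-before-not-b f[σj]≡b fᵢ≡¬b
      where
      f[σj]≡b : f (σ j) ≡ b
      f[σj]≡b = trans (σ-flips j) (trans (cong not (upward i≤j fᵢ≡¬b)) (not-involutive b))

  upper-half : ∀ i → N ≤ toℕ i → f i ≡ not b
  upper-half i N≤i with f i ≟ᵇ not b
  ... | yes fᵢ≡¬b = fᵢ≡¬b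
  ... | no  fᵢ≢¬b = contradiction (interval-injection⇒≤ σ σ-injective 1+N≤n maps) (n≮n N)
    where
    fᵢ≡b : f i ≡ b
    fᵢ≡b = trans (¬-not fᵢ≢¬b) (not-involutive b)

    1+N≤n : suc N ≤ n
    1+N≤n = ≤-trans (s≤s N≤i) (toℕ<n i)

    σ<1+i+N : ∀ j → toℕ (σ j) < suc (toℕ i) + N
    σ<1+i+N j = begin-strict
      toℕ (σ j)       <⟨ toℕ<n (σ j) ⟩
      n               ≡⟨ n≡N+N ⟩
      N + N           ≤⟨ +-monoˡ-≤ N N≤i ⟩
      toℕ i + N       <⟨ n<1+n _ ⟩
      suc (toℕ i) + N ∎
      where open ≤-Reasoning

    maps : ∀ j → 0 ≤ toℕ j → toℕ j < suc N →
           suc (toℕ i) ≤ toℕ (σ j) × toℕ (σ j) < suc (toℕ i) + N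
    maps j _ j<1+N with f j ≟ᵇ b
    ... | yes fⱼ≡b = b-before-not-b fᵢ≡b (trans (σ-flips j) (cong not fⱼ≡b)) , σ<1+i+N j
    ... | no  fⱼ≢b =
      contradiction (upward (≤-trans (s≤s⁻¹ j<1+N) N≤i) (¬-not fⱼ≢b)) (not-¬ fᵢ≡b)

  splitsAt : SplitsAt N b f
  splitsAt i = lower-half i , upper-half i

splitAt-inj₁⇒< : ∀ {m n} {i : Fin (m + n)} {j} → splitAt m i ≡ inj₁ j → toℕ i < m
splitAt-inj₁⇒< {m} {n} {j = j} eq =
  subst (_< m) (trans (sym (toℕ-↑ˡ j n)) (cong toℕ (splitAt⁻¹-↑ˡ eq))) (toℕ<n j)

splitAt-inj₂⇒≥ : ∀ {m n} {i : Fin (m + n)} {j} → splitAt m i ≡ inj₂ j → m ≤ toℕ i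
splitAt-inj₂⇒≥ {m} {j = j} eq =
  subst (m ≤_) (trans (sym (toℕ-↑ʳ m j)) (cong toℕ (splitAt⁻¹-↑ʳ eq))) (m≤m+n m (toℕ j))

stack-column-splitsAt : ∀ m b k (A B : Matrix m) →
                        SplitsAt (2 ^ m) b (λ i → lookup (stack m b k A B i) k)
stack-column-splitsAt m b k A B i with splitAt (2 ^ m) i in eq
... | inj₁ i₁ = (λ _ → insertAt-lookup (A i₁) k b)
              , λ N≤i → contradiction (splitAt-inj₁⇒< eq) (≤⇒≯ N≤i)
... | inj₂ i₂ = (λ i<N → contradiction i<N (≤⇒≯ (splitAt-inj₂⇒≥ eq)))
              , λ _ → insertAt-lookup _ k (not b)

module PreferenceColumn {m : ℕ} {P : Matrix (suc m)} (P∈C : InC (suc m) P) (k : Fin (suc m)) where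

  N : ℕ
  N = 2 ^ m

  Row : Set
  Row = Fin (2 ^ suc m)

  2^1+m≡N+N : 2 ^ suc m ≡ N + N
  2^1+m≡N+N = cong (N +_) (+-identityʳ N)

  col : Row → Bool
  col i = lookup (P i) k

  rest : Row → Vec Bool m
  rest i = removeAt (P i) k

  adjacent : ∀ i j → toℕ j ≡ suc (toℕ i) → DifferInExactlyOne (P i) (P j)
  adjacent = proj₂ P∈C

  P≡insertAt : ∀ {i c} → col i ≡ c → P i ≡ insertAt (rest i) k c
  P≡insertAt {i} cᵢ = trans (sym (insertAt-removeAt (P i) k)) (cong (insertAt (rest i) k) cᵢ)

  rest-col-injective : ∀ {i j} → rest i ≡ rest j → col i ≡ col j → i ≡ j
  rest-col-injective {i} {j} rᵢ≡rⱼ cᵢ≡cⱼ = proj₁ (proj₁ P∈C) i j (begin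
    P i                         ≡⟨ P≡insertAt cᵢ≡cⱼ ⟩
    insertAt (rest i) k (col j) ≡⟨ cong (λ r → insertAt r k (col j)) rᵢ≡rⱼ ⟩
    insertAt (rest j) k (col j) ≡⟨ P≡insertAt refl ⟨
    P j                         ∎)
    where open ≡-Reasoning

  row : Vec Bool m → Bool → Row
  row x b = proj₁ (proj₂ (proj₁ P∈C) (insertAt x k b))

  col-row : ∀ x b → col (row x b) ≡ b
  col-row x b = trans (cong (λ v → lookup v k) (proj₂ (proj₂ (proj₁ P∈C) (insertAt x k b))))
                      (insertAt-lookup x k b)

  rest-row : ∀ x b → rest (row x b) ≡ x
  rest-row x b = trans (cong (λ v → removeAt v k) (proj₂ (proj₂ (proj₁ P∈C) (insertAt x k b))))
                       (removeAt-insertAt x k b)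

  rows-differ : ∀ x b → col (row x b) ≢ col (row x (not b))
  rows-differ x b eq = not-¬ refl (trans (sym (col-row x b)) (trans eq (col-row x (not b))))

  subMatrix : Vec Bool m → List Bool
  subMatrix = subMatrixSingleton m P k

  subMatrix-pair : ∀ {x i j} → rest i ≡ x → rest j ≡ x → col i ≢ col j → toℕ i < toℕ j →
                   subMatrix x ≡ col i ∷ col j ∷ []
  subMatrix-pair {x} {i} {j} rᵢ rⱼ cᵢ≢cⱼ i<j =
    cong (map col) (filter-tabulate-pair (λ l → ≡-dec _≟ᵇ_ (rest l) x) id i<j rᵢ rⱼ only)
    where
    only : ∀ l → rest l ≡ x → l ≡ i ⊎ l ≡ j
    only l rₗ with col l ≟ᵇ col i
    ... | yes cₗ≡cᵢ = inj₁ (rest-col-injective (trans rₗ (sym rᵢ)) cₗ≡cᵢ)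
    ... | no  cₗ≢cᵢ = inj₂ (rest-col-injective (trans rₗ (sym rⱼ))
                             (trans (¬-not cₗ≢cᵢ) (sym (¬-not (cᵢ≢cⱼ ∘ sym)))))

  subMatrix-rows : ∀ x b → toℕ (row x b) < toℕ (row x (not b)) → subMatrix x ≡ b ∷ not b ∷ []
  subMatrix-rows x b lt =
    trans (subMatrix-pair (rest-row x b) (rest-row x (not b)) (rows-differ x b) lt)
          (cong₂ (λ c c′ → c ∷ c′ ∷ []) (col-row x b) (col-row x (not b)))

  subMatrix-shape : ∀ x → ∃ λ b → subMatrix x ≡ b ∷ not b ∷ []
  subMatrix-shape x with <-cmp (toℕ (row x true)) (toℕ (row x false))
  ... | tri< lt _ _ = true , subMatrix-rows x true lt
  ... | tri≈ _ eq _ = contradiction (cong col (toℕ-injective eq)) (rows-differ x true)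
  ... | tri> _ _ gt = false , subMatrix-rows x false gt

  FirstInPair : Bool → Set
  FirstInPair b = ∀ {i j} → rest i ≡ rest j → col i ≡ b → col j ≡ not b → toℕ i < toℕ j

  separable⇒firstInPair : SeparableSingleton m P k → ∃ FirstInPair
  separable⇒firstInPair separable = b , first
    where
    x₀ : Vec Bool m
    x₀ = replicate m false

    b : Bool
    b = proj₁ (subMatrix-shape x₀)

    first : FirstInPair b
    first {i} {j} rᵢ≡rⱼ cᵢ cⱼ with <-cmp (toℕ i) (toℕ j)
    ... | tri< lt _ _ = lt
    ... | tri≈ _ eq _ = contradiction (trans (sym cᵢ) (trans (cong col (toℕ-injective eq)) cⱼ))
                                      (not-¬ refl)
    ... | tri> _ _ gt = contradiction (∷-injectiveˡ (begin
      not b ∷ b ∷ []         ≡⟨ cong₂ (λ c c′ → c ∷ c′ ∷ []) cⱼ cᵢ ⟨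
      col j ∷ col i ∷ []     ≡⟨ subMatrix-pair refl rᵢ≡rⱼ (λ eq → not-¬ cᵢ (trans (sym eq) cⱼ)) gt ⟨
      subMatrix (rest j)     ≡⟨ separable (rest j) x₀ ⟩
      subMatrix x₀           ≡⟨ proj₂ (subMatrix-shape x₀) ⟩
      b ∷ not b ∷ []         ∎)) (not-¬ refl ∘ sym)
      where open ≡-Reasoning

  firstInPair⇒upward : ∀ {b} → FirstInPair b →
                       ∀ {i j} → toℕ i ≤ toℕ j → col i ≡ not b → col j ≡ not b
  firstInPair⇒upward {b} first = step-closed⇒upward-closed (λ i → col i ≡ not b) step
    where
    step : ∀ {i j} → toℕ j ≡ suc (toℕ i) → col i ≡ not b → col j ≡ not b
    step {i} {j} j≡1+i cᵢ with col j ≟ᵇ not b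
    ... | yes cⱼ  = cⱼ
    ... | no  cⱼ≢ = contradiction (first (sym same-rest) cⱼ cᵢ) j≮i
      where
      cⱼ : col j ≡ b
      cⱼ = trans (¬-not cⱼ≢) (not-involutive b)

      same-rest : rest i ≡ rest j
      same-rest = differsAt⇒removeAt-≡ {u = P i} {P j} k (adjacent i j j≡1+i)
                    (λ eq → not-¬ cⱼ (trans (sym eq) cᵢ))

      j≮i : ¬ toℕ j < toℕ i
      j≮i j<i = <-asym j<i (subst (toℕ i <_) (sym j≡1+i) (n<1+n _))

  partner : Row → Row
  partner i = row (rest i) (not (col i))

  col-partner : ∀ i → col (partner i) ≡ not (col i)
  col-partner i = col-row (rest i) (not (col i))

  partner-injective : Injective _≡_ _≡_ partner
  partner-injective {i} {j} eq = rest-col-injective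
    (trans (sym (rest-row _ _)) (trans (cong rest eq) (rest-row _ _)))
    (not-injective (trans (sym (col-partner i)) (trans (cong col eq) (col-partner j))))

  separable⇔splitsAt : SeparableSingleton m P k ⇔ ∃ λ b → SplitsAt N b col
  separable⇔splitsAt = mk⇔ to from
    where
    to : SeparableSingleton m P k → ∃ λ b → SplitsAt N b col
    to separable with separable⇒firstInPair separable
    ... | b , first = b , UpwardClosedSwapped.splitsAt 2^1+m≡N+N col b
                            (firstInPair⇒upward first) partner partner-injective col-partner

    from : (∃ λ b → SplitsAt N b col) → SeparableSingleton m P k
    from (b , split) x y = trans (pairs-ordered x) (sym (pairs-ordered y))
      where
      pairs-ordered : ∀ x → subMatrix x ≡ b ∷ not b ∷ []
      pairs-ordered x = subMatrix-rows x b
        (<-≤-trans (splitsAt-≡⇒< split (col-row x b)) (splitsAt-≡not⇒≥ split (col-row x (not b))))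

  columnForm⇔splitsAt : (ColumnTopOnes m P k ⊎ ColumnTopZeros m P k) ⇔ ∃ λ b → SplitsAt N b col
  columnForm⇔splitsAt = mk⇔ to from
    where
    to : ColumnTopOnes m P k ⊎ ColumnTopZeros m P k → ∃ λ b → SplitsAt N b col
    to (inj₁ ones)  = true  , Equivalence.from (splitsAt⇔≡<ᵇ id refl) ones
    to (inj₂ zeros) = false , Equivalence.from (splitsAt⇔≡<ᵇ not refl) zeros

    from : (∃ λ b → SplitsAt N b col) → ColumnTopOnes m P k ⊎ ColumnTopZeros m P k
    from (true  , split) = inj₁ (Equivalence.to (splitsAt⇔≡<ᵇ id refl) split)
    from (false , split) = inj₂ (Equivalence.to (splitsAt⇔≡<ᵇ not refl) split)

  block∈C : ∀ o c (embed : Fin N → Row) → (∀ j → toℕ (embed j) ≡ o + toℕ j) →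
            (∀ j → col (embed j) ≡ c) → (∀ i → col i ≡ c → o ≤ toℕ i × toℕ i < o + N) →
            InC m (rest ∘ embed)
  block∈C o c embed toℕ-embed col-embed inBlock = (injective , surjective) , adjacent-rows
    where
    embed-injective : Injective _≡_ _≡_ embed
    embed-injective eq = toℕ-injective (+-cancelˡ-≡ o _ _
      (trans (sym (toℕ-embed _)) (trans (cong toℕ eq) (toℕ-embed _))))

    injective : ∀ i j → rest (embed i) ≡ rest (embed j) → i ≡ j
    injective i j eq = embed-injective (rest-col-injective eq (trans (col-embed i) (sym (col-embed j))))

    surjective : ∀ x → ∃ λ j → rest (embed j) ≡ x
    surjective x = j , trans (cong rest embed-j) (rest-row x c)
      where
      o≤r : o ≤ toℕ (row x c)
      o≤r = proj₁ (inBlock _ (col-row x c))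

      r-o<N : toℕ (row x c) ∸ o < N
      r-o<N = subst (toℕ (row x c) ∸ o <_) (m+n∸m≡n o N)
                    (∸-monoˡ-< (proj₂ (inBlock _ (col-row x c))) o≤r)

      j : Fin N
      j = fromℕ< r-o<N

      embed-j : embed j ≡ row x c
      embed-j = toℕ-injective (trans (toℕ-embed j)
                  (trans (cong (o +_) (toℕ-fromℕ< r-o<N)) (m+[n∸m]≡n o≤r)))

    adjacent-rows : ∀ i j → toℕ j ≡ suc (toℕ i) → DifferInExactlyOne (rest (embed i)) (rest (embed j))
    adjacent-rows i j j≡1+i = agreesAt⇒removeAt-differs {u = P (embed i)} {P (embed j)} k (adjacent (embed i) (embed j) embeds-adjacent)
                                (trans (col-embed i) (sym (col-embed j)))
      where
      open ≡-Reasoning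
      embeds-adjacent : toℕ (embed j) ≡ suc (toℕ (embed i))
      embeds-adjacent = begin
        toℕ (embed j)       ≡⟨ toℕ-embed j ⟩
        o + toℕ j           ≡⟨ cong (o +_) j≡1+i ⟩
        o + suc (toℕ i)     ≡⟨ +-suc o (toℕ i) ⟩
        suc (o + toℕ i)     ≡⟨ cong suc (toℕ-embed i) ⟨
        suc (toℕ (embed i)) ∎

  module Halves {b : Bool} (split : SplitsAt N b col) where

    top : Fin N → Row
    top j = j ↑ˡ (N + 0)

    bottom : Fin N → Row
    bottom j = N ↑ʳ cast (sym (+-identityʳ N)) j

    toℕ-bottom : ∀ j → toℕ (bottom j) ≡ N + toℕ j
    toℕ-bottom j = trans (toℕ-↑ʳ N _) (cong (N +_) (toℕ-cast _ j))

    col-top : ∀ j → col (top j) ≡ b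
    col-top j = proj₁ (split (top j)) (subst (_< N) (sym (toℕ-↑ˡ j _)) (toℕ<n j))

    col-bottom : ∀ j → col (bottom j) ≡ not b
    col-bottom j = proj₂ (split (bottom j)) (subst (N ≤_) (sym (toℕ-bottom j)) (m≤m+n N _))

    P₁ P₂ : Matrix m
    P₁ = rest ∘ top
    P₂ = rest ∘ bottom

    P₁∈C : InC m P₁
    P₁∈C = block∈C 0 b top (λ j → toℕ-↑ˡ j _) col-top
             (λ i cᵢ → z≤n , splitsAt-≡⇒< split cᵢ)

    P₂∈S : InS m P₁ P₂
    P₂∈S = block∈C N (not b) bottom toℕ-bottom col-bottom
             (λ i cᵢ → splitsAt-≡not⇒≥ split cᵢ , subst (toℕ i <_) 2^1+m≡N+N (toℕ<n i))
         , λ i j i≡0 1+j≡N → sym (differsAt⇒removeAt-≡ {u = P (top j)} {P (bottom i)} k (adjacent (top j) (bottom i) (begin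
             toℕ (bottom i)   ≡⟨ toℕ-bottom i ⟩
             N + toℕ i        ≡⟨ cong (N +_) i≡0 ⟩
             N + 0            ≡⟨ +-identityʳ N ⟩
             N                ≡⟨ 1+j≡N ⟨
             suc (toℕ j)      ≡⟨ cong suc (toℕ-↑ˡ j _) ⟨
             suc (toℕ (top j)) ∎))
             (λ eq → not-¬ (col-top j) (trans eq (col-bottom i))))
      where open ≡-Reasoning

    P≋stack : P ≋ stack m b k P₁ P₂
    P≋stack i with splitAt (2 ^ m) i in eq
    ... | inj₁ i₁ = subst (λ l → P l ≡ insertAt (P₁ i₁) k b) (splitAt⁻¹-↑ˡ eq) (P≡insertAt (col-top i₁))
    ... | inj₂ i₂ = subst (λ l → P l ≡ insertAt (P₂ i₂′) k (not b)) bottom-i₂′ (P≡insertAt (col-bottom i₂′))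
      where
      i₂′ : Fin N
      i₂′ = cast (+-identityʳ N) i₂

      bottom-i₂′ : bottom i₂′ ≡ i
      bottom-i₂′ = trans (cong (N ↑ʳ_) (cast-involutive (sym (+-identityʳ N)) (+-identityʳ N) i₂)) (splitAt⁻¹-↑ʳ eq)

  splitsAt⇔stack : (∃ λ b → SplitsAt N b col) ⇔
    (Σ (Matrix m) λ P₁ → Σ (Matrix m) λ P₂ → InC m P₁ × InS m P₁ P₂ ×
       ((P ≋ stack m true k P₁ P₂) ⊎ (P ≋ stack m false k P₁ P₂)))
  splitsAt⇔stack = mk⇔ to from
    where
    to : (∃ λ b → SplitsAt N b col) →
         Σ (Matrix m) λ P₁ → Σ (Matrix m) λ P₂ → InC m P₁ × InS m P₁ P₂ ×
           ((P ≋ stack m true k P₁ P₂) ⊎ (P ≋ stack m false k P₁ P₂))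
    to (true  , split) = let open Halves split in P₁ , P₂ , P₁∈C , P₂∈S , inj₁ P≋stack
    to (false , split) = let open Halves split in P₁ , P₂ , P₁∈C , P₂∈S , inj₂ P≋stack

    stack⇒splitsAt : ∀ {b A B} → P ≋ stack m b k A B → SplitsAt N b col
    stack⇒splitsAt {b} {A} {B} eq i =
      Product.map (trans same-col ∘_) (trans same-col ∘_) (stack-column-splitsAt m b k A B i)
      where
      same-col : col i ≡ lookup (stack m b k A B i) k
      same-col = cong (λ v → lookup v k) (eq i)

    from : (Σ (Matrix m) λ P₁ → Σ (Matrix m) λ P₂ → InC m P₁ × InS m P₁ P₂ ×
              ((P ≋ stack m true k P₁ P₂) ⊎ (P ≋ stack m false k P₁ P₂))) →
           ∃ λ b → SplitsAt N b col
    from (_ , _ , _ , _ , inj₁ eq) = true  , stack⇒splitsAt eq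
    from (_ , _ , _ , _ , inj₂ eq) = false , stack⇒splitsAt eq

theorem5 : (m : ℕ) (P : Matrix (suc m)) → InC (suc m) P → (k : Fin (suc m)) →
    (SeparableSingleton m P k ⇔ (ColumnTopOnes m P k ⊎ ColumnTopZeros m P k))
    × ((ColumnTopOnes m P k ⊎ ColumnTopZeros m P k) ⇔
       (Σ (Matrix m) λ P₁ → Σ (Matrix m) λ P₂ → InC m P₁ × InS m P₁ P₂ ×
          ((P ≋ stack m true k P₁ P₂) ⊎ (P ≋ stack m false k P₁ P₂))))
theorem5 m P P∈C k = ⇔-sym columnForm⇔splitsAt ⇔-∘ separable⇔splitsAt
                   , splitsAt⇔stack ⇔-∘ columnForm⇔splitsAt
  where open PreferenceColumn P∈C k
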